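{- Let $\lesssim$ be a plausible preorder on $\mathcal{T}$ and $E(\cdot|\cdot)$ the conditional expectation naturally induced by it. Let $X$ be a random quantity and $C,D$ events. If $E(X.C|D)\in\{ -\infty,+\infty\}$, then $E(X|C.D)=E(X.C|D)$.
   Context: Random quantities: $\mathcal{T}$ is a unital associative commutative algebra over $\mathbb{R}$; reals $r$ are identified with $r\mathbf{1}$; products are written $X.Y$. Events: idempotents $A$ ($A.A=A$). Plausible preorder: a relation $\lesssim$ on $\mathcal{T}$ with (i) $0\lesssim A$ for every event $A$; (ii) $0\lesssim X$ and $0\lesssim Y$ imply $0\lesssim X+Y$; (iii) $0\lesssim X$ and real $q\ge0$ imply $0\lesssim qX$; (iv) $X\lesssim Y$ iff $0\lesssim Y-X$. Strict part: $X\lnsim Y$ iff $X\lesssim Y$ and not $Y\lesssim X$. Conditional preorder: $X\lesssim_C Y$ iff $X.C\lesssim Y.C$; strict part $\lnsim_C$. Expectation induced by a plausible preorder: $E(X)$ is the real $x$ if $-\epsilon\lnsim X-x\lnsim\epsilon$ for all reals $\epsilon>0$; it is $+\infty$ if $y\lnsim X$ for all reals $y$; it is $-\infty$ if $X\lnsim y$ for all reals $y$; it is undefined otherwise. Conditional expectation: $E(X|C)$ is the expectation induced by $\lesssim_C$. -}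

module Defs where

open import Level using (0ℓ)
open import Data.Product using (Σ; _×_; ∃)
open import Data.Empty using (⊥)
open import Relation.Nullary using (¬_)
open import Relation.Binary.PropositionalEquality using (_≡_; _≢_)
open import Relation.Binary.Structures using (IsTotalOrder)
open import Algebra.Structures using (IsCommutativeRing)

-- The real numbers, axiomatised as a complete ordered field.
-- (agda-stdlib has no reals; any model of these axioms is isomorphic
-- to ℝ, so quantifying over an arbitrary model is faithful.)

record RealField : Set₁ where
  infixl 6 _+_
  infixl 7 _*_
  infix  4 _≤_ _<_
  field
    ℝ   : Set
    _+_ _*_ : ℝ → ℝ → ℝ
    -_  : ℝ → ℝ
    0ℝ 1ℝ : ℝ
    _≤_ : ℝ → ℝ → Set
    isCommutativeRing : IsCommutativeRing _≡_ _+_ _*_ -_ 0ℝ 1ℝ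
    0≢1     : 0ℝ ≢ 1ℝ
    inverse : ∀ x → x ≢ 0ℝ → Σ ℝ (λ y → x * y ≡ 1ℝ)
    isTotalOrder : IsTotalOrder _≡_ _≤_
    +-mono-≤ : ∀ {a b} c → a ≤ b → a + c ≤ b + c
    *-nonneg : ∀ {a b} → 0ℝ ≤ a → 0ℝ ≤ b → 0ℝ ≤ a * b
    complete : (S : ℝ → Set) → ∃ S → (Σ ℝ λ u → ∀ s → S s → s ≤ u) →
               Σ ℝ λ l → (∀ s → S s → s ≤ l) ×
                         (∀ u → (∀ s → S s → s ≤ u) → l ≤ u)

  _<_ : ℝ → ℝ → Set
  a < b = a ≤ b × a ≢ b

-- Random quantities: a unital associative commutative algebra over ℝ.

record RAlgebra (R : RealField) : Set₁ where
  open RealField R using (ℝ) renaming (_+_ to _+ℝ_; _*_ to _*ℝ_; 1ℝ to 1r)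
  infixl 6 _+_
  infixl 7 _·_
  infixr 8 _∙_
  field
    𝒯   : Set
    _+_ _·_ : 𝒯 → 𝒯 → 𝒯      -- X.Y is written X · Y
    -_  : 𝒯 → 𝒯
    𝟎 𝟏 : 𝒯
    _∙_ : ℝ → 𝒯 → 𝒯
    isCommutativeRing : IsCommutativeRing _≡_ _+_ _·_ -_ 𝟎 𝟏
    ∙-distribʳ : ∀ a b X → (a +ℝ b) ∙ X ≡ a ∙ X + b ∙ X
    ∙-distribˡ : ∀ a X Y → a ∙ (X + Y) ≡ a ∙ X + a ∙ Y
    ∙-assoc    : ∀ a b X → (a *ℝ b) ∙ X ≡ a ∙ (b ∙ X)
    ∙-identity : ∀ X → 1r ∙ X ≡ X
    ∙-·-assoc  : ∀ a X Y → (a ∙ X) · Y ≡ a ∙ (X · Y)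

  ι : ℝ → 𝒯
  ι r = r ∙ 𝟏

  _-_ : 𝒯 → 𝒯 → 𝒯
  X - Y = X + (- Y)

  IsEvent : 𝒯 → Set
  IsEvent A = A · A ≡ A

module _ {R : RealField} (𝒜 : RAlgebra R) where
  open RealField R using (ℝ; 0ℝ) renaming (_≤_ to _≤ℝ_)
  open RAlgebra 𝒜

  record PlausiblePreorder : Set₁ where
    infix 4 _≲_
    field
      _≲_ : 𝒯 → 𝒯 → Set
      event-nonneg : ∀ A → IsEvent A → 𝟎 ≲ A
      add-nonneg   : ∀ X Y → 𝟎 ≲ X → 𝟎 ≲ Y → 𝟎 ≲ X + Y
      scale-nonneg : ∀ X (q : ℝ) → 0ℝ ≤ℝ q → 𝟎 ≲ X → 𝟎 ≲ q ∙ X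
      ≲-iff        : ∀ X Y → (X ≲ Y → 𝟎 ≲ Y - X) × (𝟎 ≲ Y - X → X ≲ Y)

  Strict : (𝒯 → 𝒯 → Set) → 𝒯 → 𝒯 → Set
  Strict _≾_ X Y = X ≾ Y × ¬ (Y ≾ X)

  Cond : (𝒯 → 𝒯 → Set) → 𝒯 → 𝒯 → 𝒯 → Set
  Cond _≾_ C X Y = (X · C) ≾ (Y · C)

  data ℝ̄ : Set where
    fin  : ℝ → ℝ̄
    +∞ -∞ : ℝ̄

  -- "the expectation of X induced by the relation ≾ equals v"
  -- (E(X) is undefined iff no v satisfies this)
  ExpectationIs : (𝒯 → 𝒯 → Set) → 𝒯 → ℝ̄ → Set
  ExpectationIs _≾_ X (fin x) =
    ∀ (ε : ℝ) → RealField._<_ R 0ℝ ε →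
      Strict _≾_ (ι (RealField.-_ R ε)) (X - ι x) × Strict _≾_ (X - ι x) (ι ε)
  ExpectationIs _≾_ X +∞ = ∀ (y : ℝ) → Strict _≾_ (ι y) X
  ExpectationIs _≾_ X -∞ = ∀ (y : ℝ) → Strict _≾_ X (ι y)

  CondExpectationIs : PlausiblePreorder → 𝒯 → 𝒯 → ℝ̄ → Set
  CondExpectationIs P X C v = ExpectationIs (Cond (PlausiblePreorder._≲_ P) C) X v

-- For y ≥ 0, ι y · (C · D) ≲ ι y · D, since the difference is y ∙ (D - C · D) and
-- D - C · D is an event; for y ≤ 0, ι y · (C · D) ≲ 𝟎 = ι 0 · D. So each
-- ι y · (C · D) lies below some ι y' · D, and X · C · D being strictly above all
-- of the latter (E(X.C|D) = +∞) puts it strictly above all of the former.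
-- The case -∞ is symmetric.
module Submission where

open import Defs
open import Data.Sum using (_⊎_)
open import Relation.Binary.PropositionalEquality using (_≡_)

open import Level using (0ℓ)
open import Data.Sum using (inj₁; inj₂)
open import Data.Product using (Σ; _,_; proj₁; proj₂)
open import Relation.Binary.PropositionalEquality
  using (refl; sym; trans; cong; cong₂; subst; subst₂; module ≡-Reasoning)
open import Relation.Binary.Definitions using (Transitive)
open import Relation.Binary.Structures using (IsTotalOrder)
open import Algebra.Structures using (IsCommutativeRing)
open import Algebra.Bundles using (CommutativeRing)
import Algebra.Properties.Ring as RingProperties
import Algebra.Properties.CommutativeSemigroup as CommutativeSemigroupProperties

module RandomQuantities {R : RealField} (𝒜 : RAlgebra R) where
  open RealField R using (ℝ; 0ℝ) renaming (_≤_ to _≤ℝ_; -_ to -ℝ_)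
  open RAlgebra 𝒜
  open ≡-Reasoning

  module 𝒯 = IsCommutativeRing isCommutativeRing

  private
    module ℝ = IsCommutativeRing (RealField.isCommutativeRing R)

    𝒯-commutativeRing : CommutativeRing 0ℓ 0ℓ
    𝒯-commutativeRing = record { isCommutativeRing = isCommutativeRing }

  open RingProperties (CommutativeRing.ring 𝒯-commutativeRing)
    using (x+x≈x⇒x≈0; +-inverseˡ-unique; -0#≈0#; x[y-z]≈xy-xz; [y-z]x≈yx-zx; ⁻¹-anti-homo‿-)
  open CommutativeSemigroupProperties (CommutativeRing.*-commutativeSemigroup 𝒯-commutativeRing)
    using (interchange)

  -- Defs declares no fixity for _-_, so it binds tighter than _·_ and _∙_;
  -- _⊖_ is the same subtraction at the precedence of _+_.
  infixl 6 _⊖_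
  _⊖_ : 𝒯 → 𝒯 → 𝒯
  X ⊖ Y = X - Y

  neg-nonneg : ∀ {y} → y ≤ℝ 0ℝ → 0ℝ ≤ℝ -ℝ y
  neg-nonneg {y} y≤0 = subst₂ _≤ℝ_ (ℝ.-‿inverseʳ y) (ℝ.+-identityˡ (-ℝ y))
                         (RealField.+-mono-≤ R (-ℝ y) y≤0)

  ι-· : ∀ a X → ι a · X ≡ a ∙ X
  ι-· a X = trans (∙-·-assoc a 𝟏 X) (cong (a ∙_) (𝒯.*-identityˡ X))

  ∙-zeroʳ : ∀ a → a ∙ 𝟎 ≡ 𝟎
  ∙-zeroʳ a = x+x≈x⇒x≈0 (a ∙ 𝟎)
    (trans (sym (∙-distribˡ a 𝟎 𝟎)) (cong (a ∙_) (𝒯.+-identityˡ 𝟎)))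

  ∙-zeroˡ : ∀ X → 0ℝ ∙ X ≡ 𝟎
  ∙-zeroˡ X = x+x≈x⇒x≈0 (0ℝ ∙ X)
    (trans (sym (∙-distribʳ 0ℝ 0ℝ X)) (cong (_∙ X) (ℝ.+-identityˡ 0ℝ)))

  ∙-negʳ : ∀ a X → a ∙ (- X) ≡ - (a ∙ X)
  ∙-negʳ a X = +-inverseˡ-unique (a ∙ (- X)) (a ∙ X)
    (trans (sym (∙-distribˡ a (- X) X)) (trans (cong (a ∙_) (𝒯.-‿inverseˡ X)) (∙-zeroʳ a)))

  ∙-negˡ : ∀ a X → (-ℝ a) ∙ X ≡ - (a ∙ X)
  ∙-negˡ a X = +-inverseˡ-unique ((-ℝ a) ∙ X) (a ∙ X)
    (trans (sym (∙-distribʳ (-ℝ a) a X)) (trans (cong (_∙ X) (ℝ.-‿inverseˡ a)) (∙-zeroˡ X)))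

  ∙-distrib-sub : ∀ a X Y → a ∙ (X ⊖ Y) ≡ a ∙ X ⊖ a ∙ Y
  ∙-distrib-sub a X Y = trans (∙-distribˡ a X (- Y)) (cong (a ∙ X +_) (∙-negʳ a Y))

  infix 4 _⊆_
  _⊆_ : 𝒯 → 𝒯 → Set
  A ⊆ B = A · B ≡ A

  ·-event : ∀ {A B} → IsEvent A → IsEvent B → IsEvent (A · B)
  ·-event {A} {B} evA evB = trans (interchange A B A B) (cong₂ _·_ evA evB)

  ·-⊆ʳ : ∀ {A B} → IsEvent B → A · B ⊆ B
  ·-⊆ʳ {A} {B} evB = trans (𝒯.*-assoc A B B) (cong (A ·_) evB)

  ⊆-difference-event : ∀ {A B} → IsEvent A → IsEvent B → A ⊆ B → IsEvent (B ⊖ A)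
  ⊆-difference-event {A} {B} evA evB A⊆B = begin
    (B ⊖ A) · (B ⊖ A)                          ≡⟨ [y-z]x≈yx-zx (B ⊖ A) B A ⟩
    B · (B ⊖ A) ⊖ A · (B ⊖ A)                  ≡⟨ cong₂ _⊖_ (x[y-z]≈xy-xz B B A) (x[y-z]≈xy-xz A B A) ⟩
    (B · B ⊖ B · A) ⊖ (A · B ⊖ A · A)          ≡⟨ cong₂ _⊖_ (cong₂ _⊖_ evB B·A≡A) (cong₂ _⊖_ A⊆B evA) ⟩
    (B ⊖ A) ⊖ (A ⊖ A)                          ≡⟨ cong (λ t → (B ⊖ A) ⊖ t) (𝒯.-‿inverseʳ A) ⟩
    (B ⊖ A) ⊖ 𝟎                                ≡⟨ cong ((B ⊖ A) +_) -0#≈0# ⟩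
    (B ⊖ A) + 𝟎                                ≡⟨ 𝒯.+-identityʳ (B ⊖ A) ⟩
    B ⊖ A                                      ∎
    where
    B·A≡A : B · A ≡ A
    B·A≡A = trans (𝒯.*-comm B A) A⊆B

  module _ {_≾_ : 𝒯 → 𝒯 → Set} (≾-trans : Transitive _≾_) where

    ≾-<-trans : ∀ {X Y Z} → X ≾ Y → Strict 𝒜 _≾_ Y Z → Strict 𝒜 _≾_ X Z
    ≾-<-trans X≾Y (Y≾Z , Z⋡Y) = ≾-trans X≾Y Y≾Z , λ Z≾X → Z⋡Y (≾-trans Z≾X X≾Y)

    <-≾-trans : ∀ {X Y Z} → Strict 𝒜 _≾_ X Y → Y ≾ Z → Strict 𝒜 _≾_ X Z
    <-≾-trans (X≾Y , Y⋡X) Y≾Z = ≾-trans X≾Y Y≾Z , λ Z≾X → Y⋡X (≾-trans Y≾Z Z≾X)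

  module _ (P : PlausiblePreorder 𝒜) where
    open PlausiblePreorder P

    ≲-trans : Transitive _≲_
    ≲-trans {X} {Y} {Z} X≲Y Y≲Z = proj₂ (≲-iff X Z) (subst (𝟎 ≲_) telescope
        (add-nonneg _ _ (proj₁ (≲-iff Y Z) Y≲Z) (proj₁ (≲-iff X Y) X≲Y)))
      where
      telescope : (Z ⊖ Y) + (Y ⊖ X) ≡ Z ⊖ X
      telescope = begin
        (Z ⊖ Y) + (Y ⊖ X)     ≡⟨ 𝒯.+-assoc Z (- Y) (Y ⊖ X) ⟩
        Z + (- Y + (Y ⊖ X))   ≡⟨ cong (Z +_) (sym (𝒯.+-assoc (- Y) Y (- X))) ⟩
        Z + ((- Y + Y) ⊖ X)   ≡⟨ cong (λ t → Z + (t ⊖ X)) (𝒯.-‿inverseˡ Y) ⟩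
        Z + (𝟎 ⊖ X)           ≡⟨ cong (Z +_) (𝒯.+-identityˡ (- X)) ⟩
        Z ⊖ X                 ∎

    ≲-by-scaled-event : ∀ {X Y E q} → IsEvent E → 0ℝ ≤ℝ q → Y ⊖ X ≡ q ∙ E → X ≲ Y
    ≲-by-scaled-event {X} {Y} {E} {q} evE 0≤q Y-X≡q∙E = proj₂ (≲-iff X Y)
      (subst (𝟎 ≲_) (sym Y-X≡q∙E) (scale-nonneg E q 0≤q (event-nonneg E evE)))

    module _ {A B} (evA : IsEvent A) (evB : IsEvent B) (A⊆B : A ⊆ B) where

      ι-·-mono-⊆ : ∀ {y} → 0ℝ ≤ℝ y → ι y · A ≲ ι y · B
      ι-·-mono-⊆ {y} 0≤y = ≲-by-scaled-event (⊆-difference-event evA evB A⊆B) 0≤y (begin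
        ι y · B ⊖ ι y · A   ≡⟨ cong₂ _⊖_ (ι-· y B) (ι-· y A) ⟩
        y ∙ B ⊖ y ∙ A       ≡⟨ sym (∙-distrib-sub y B A) ⟩
        y ∙ (B ⊖ A)         ∎)

      ι-·-antimono-⊆ : ∀ {y} → y ≤ℝ 0ℝ → ι y · B ≲ ι y · A
      ι-·-antimono-⊆ {y} y≤0 = ≲-by-scaled-event (⊆-difference-event evA evB A⊆B) (neg-nonneg y≤0) (begin
        ι y · A ⊖ ι y · B   ≡⟨ cong₂ _⊖_ (ι-· y A) (ι-· y B) ⟩
        y ∙ A ⊖ y ∙ B       ≡⟨ sym (⁻¹-anti-homo‿- (y ∙ B) (y ∙ A)) ⟩
        - (y ∙ B ⊖ y ∙ A)   ≡⟨ cong -_ (sym (∙-distrib-sub y B A)) ⟩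
        - (y ∙ (B ⊖ A))     ≡⟨ sym (∙-negˡ y (B ⊖ A)) ⟩
        (-ℝ y) ∙ (B ⊖ A)    ∎)

      ι-·-nonpos : ∀ {y} → y ≤ℝ 0ℝ → ι y · A ≲ ι 0ℝ · B
      ι-·-nonpos {y} y≤0 = ≲-by-scaled-event evA (neg-nonneg y≤0) (begin
        ι 0ℝ · B ⊖ ι y · A   ≡⟨ cong₂ _⊖_ (trans (ι-· 0ℝ B) (∙-zeroˡ B)) (ι-· y A) ⟩
        𝟎 ⊖ y ∙ A            ≡⟨ 𝒯.+-identityˡ (- (y ∙ A)) ⟩
        - (y ∙ A)            ≡⟨ sym (∙-negˡ y A) ⟩
        (-ℝ y) ∙ A           ∎)

      ι-·-nonneg : ∀ {y} → 0ℝ ≤ℝ y → ι 0ℝ · B ≲ ι y · A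
      ι-·-nonneg {y} 0≤y = ≲-by-scaled-event evA 0≤y (begin
        ι y · A ⊖ ι 0ℝ · B   ≡⟨ cong₂ _⊖_ (ι-· y A) (trans (ι-· 0ℝ B) (∙-zeroˡ B)) ⟩
        y ∙ A ⊖ 𝟎            ≡⟨ cong (y ∙ A +_) -0#≈0# ⟩
        y ∙ A + 𝟎            ≡⟨ 𝒯.+-identityʳ (y ∙ A) ⟩
        y ∙ A                ∎)

      ι-·-bounded-above : ∀ y → Σ ℝ λ y' → ι y · A ≲ ι y' · B
      ι-·-bounded-above y with IsTotalOrder.total (RealField.isTotalOrder R) 0ℝ y
      ... | inj₁ 0≤y = y , ι-·-mono-⊆ 0≤y
      ... | inj₂ y≤0 = 0ℝ , ι-·-nonpos y≤0

      ι-·-bounded-below : ∀ y → Σ ℝ λ y' → ι y' · B ≲ ι y · A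
      ι-·-bounded-below y with IsTotalOrder.total (RealField.isTotalOrder R) 0ℝ y
      ... | inj₁ 0≤y = 0ℝ , ι-·-nonneg 0≤y
      ... | inj₂ y≤0 = y , ι-·-antimono-⊆ y≤0

      ι-·-<-restrict : ∀ {Z} → (∀ y → Strict 𝒜 _≲_ (ι y · B) Z) → ∀ y → Strict 𝒜 _≲_ (ι y · A) Z
      ι-·-<-restrict ιB<Z y =
        ≾-<-trans {_≾_ = _≲_} ≲-trans (proj₂ (ι-·-bounded-above y)) (ιB<Z (proj₁ (ι-·-bounded-above y)))

      <-ι-·-restrict : ∀ {Z} → (∀ y → Strict 𝒜 _≲_ Z (ι y · B)) → ∀ y → Strict 𝒜 _≲_ Z (ι y · A)
      <-ι-·-restrict Z<ιB y =
        <-≾-trans {_≾_ = _≲_} ≲-trans (Z<ιB (proj₁ (ι-·-bounded-below y))) (proj₂ (ι-·-bounded-below y))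

mainTheorem8 : (R : RealField) (𝒜 : RAlgebra R) (P : PlausiblePreorder 𝒜)
               (X C D : RAlgebra.𝒯 𝒜) → RAlgebra.IsEvent 𝒜 C → RAlgebra.IsEvent 𝒜 D →
               (v : ℝ̄ 𝒜) → (v ≡ +∞ ⊎ v ≡ -∞) →
               CondExpectationIs 𝒜 P (RAlgebra._·_ 𝒜 X C) D v →
               CondExpectationIs 𝒜 P X (RAlgebra._·_ 𝒜 C D) v
mainTheorem8 R 𝒜 P X C D evC evD .+∞ (inj₁ refl) E[XC∣D]≡+∞ y =
  subst (Strict 𝒜 _≲_ _) (𝒯.*-assoc X C D)
    (ι-·-<-restrict P (·-event evC evD) evD (·-⊆ʳ evD) E[XC∣D]≡+∞ y)
  where open RAlgebra 𝒜; open PlausiblePreorder P; open RandomQuantities 𝒜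
mainTheorem8 R 𝒜 P X C D evC evD .-∞ (inj₂ refl) E[XC∣D]≡-∞ y =
  subst (λ Z → Strict 𝒜 _≲_ Z (ι y · (C · D))) (𝒯.*-assoc X C D)
    (<-ι-·-restrict P (·-event evC evD) evD (·-⊆ʳ evD) E[XC∣D]≡-∞ y)
  where open RAlgebra 𝒜; open PlausiblePreorder P; open RandomQuantities 𝒜
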